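{- Let $\Gamma$ be a finite connected graph, regarded as the graph induced on its vertex set in its universal orthogonal embedding $(V_\Gamma,Q_\Gamma)$ with associated bilinear form $f$. Let $v$ be a vertex and $C: v=v_1,v_2,\dots,v_n$ a minimal cycle on the distinct vertices $v_1,\dots,v_n$ of $\Gamma$, and let $w_1,\dots,w_l$ be the vertices outside $C$. Let $\Delta$ be the graph obtained from $\Gamma$ by the sequence of elementary transformations $$(v_2,v),(v_3,\tau_{v_2}(v)),\dots,(v_{n-1},\tau_{v_{n-2}}\cdots\tau_{v_2}(v)),$$ followed, for $j=1,\dots,l$ in turn, by $$(v_2,w_j),(v_3,\tau_{v_2}(w_j)),\dots,(v_{n-1},\tau_{v_{n-2}}\cdots\tau_{v_2}(w_j)).$$ Then $d_\Delta(\tau_{v_{n-1}}\tau_{v_{n-2}}\cdots\tau_{v_2}(v))=d_\Gamma(v)-1$.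
   Context: Universal embedding: for a graph $\Gamma$ with vertex set $\mathcal V$, $V_\Gamma$ is the $\mathbb F_2$-space of finite subsets of $\mathcal V$ under symmetric difference, a vertex $v$ identified with $\{v\}$; with a total order $<$ on $\mathcal V$, $g_\Gamma(u,w)$ is the number mod 2 of pairs $(x,y)\in u\times w$ with $x=y$ or ($x<y$ and $\{x,y\}$ an edge), and $Q_\Gamma(u)=g_\Gamma(u,u)$; $f(u,w)=Q_\Gamma(u+w)+Q_\Gamma(u)+Q_\Gamma(w)$. Thus for vertices $f(v,w)=1$ iff $v,w$ adjacent. For a set $\mathcal W$ of vectors with $Q_\Gamma=1$, the induced graph has vertex set $\mathcal W$, distinct $x,y$ adjacent iff $Q_\Gamma(x+y)=1$. For a vector $u$, $\tau_u(x)=x+f(u,x)u$. An elementary transformation $(u,x)$ of the graph induced on $\mathcal W$ (with $u,x\in\mathcal W$) replaces it by the graph induced on $(\mathcal W\setminus\{x\})\cup\{\tau_u(x)\}$. A minimal cycle is a cycle $v_1,\dots,v_n$ ($n\ge 3$) whose vertices induce a cycle in $\Gamma$ (no chords). $d_\Gamma(x)$ denotes the degree of $x$ in $\Gamma$. -}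

module Defs where

open import Data.Nat using (ℕ; zero; suc; _∸_; _≤_; _<_; _<ᵇ_)
open import Data.Bool using (Bool; true; false; _∧_; _∨_; not; _xor_; if_then_else_)
import Data.Bool.Properties as BoolP
open import Data.Fin using (Fin; toℕ; _≟_)
open import Data.Vec using (Vec; tabulate; zipWith; lookup)
open import Data.Vec.Properties using (≡-dec)
open import Data.List using (List; []; _∷_; map; filterᵇ; length; allFin; foldl)
open import Data.List.Relation.Unary.Any using (any?)
open import Data.Product using (Σ; _×_; _,_)
open import Data.Sum using (_⊎_)
open import Relation.Binary.PropositionalEquality using (_≡_; _≢_)
open import Relation.Nullary using (does; ¬_)

record Graph (N : ℕ) : Set where
  field
    adj     : Fin N → Fin N → Bool
    adj-sym : ∀ i j → adj i j ≡ adj j i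
    irrefl  : ∀ i → adj i i ≡ false
open Graph public

data Walk {N : ℕ} (Γ : Graph N) : Fin N → Fin N → Set where
  here : ∀ {i} → Walk Γ i i
  step : ∀ {i j k} → adj Γ i j ≡ true → Walk Γ j k → Walk Γ i k

Connected : {N : ℕ} → Graph N → Set
Connected {N} Γ = (i j : Fin N) → Walk Γ i j

degΓ : {N : ℕ} → Graph N → Fin N → ℕ
degΓ {N} Γ v = length (filterᵇ (adj Γ v) (allFin N))

-- The universal embedding V_Γ: subsets of Fin N as characteristic vectors.
V : ℕ → Set
V N = Vec Bool N

_==_ : {N : ℕ} → V N → V N → Bool
u == w = does (≡-dec BoolP._≟_ u w)

_⊕_ : {N : ℕ} → V N → V N → V N
u ⊕ w = zipWith _xor_ u w

vec : {N : ℕ} → Fin N → V N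
vec i = tabulate (λ k → does (k ≟ i))

⊕Σ : {n : ℕ} → (Fin n → Bool) → Bool
⊕Σ {zero}  f = false
⊕Σ {suc n} f = f Fin.zero xor ⊕Σ (λ k → f (Fin.suc k))
  where import Data.Fin as Fin

g : {N : ℕ} → Graph N → V N → V N → Bool
g Γ u w = ⊕Σ (λ x → ⊕Σ (λ y →
  lookup u x ∧ lookup w y ∧ (does (x ≟ y) ∨ ((toℕ x <ᵇ toℕ y) ∧ adj Γ x y))))

Q : {N : ℕ} → Graph N → V N → Bool
Q Γ u = g Γ u u

f : {N : ℕ} → Graph N → V N → V N → Bool
f Γ u w = Q Γ (u ⊕ w) xor Q Γ u xor Q Γ w

τ : {N : ℕ} → Graph N → V N → V N → V N
τ Γ u x = if f Γ u x then x ⊕ u else x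

-- Finite sets of vectors are represented by duplicate-free lists.
-- add an element to a set (no effect if already present)
insert : {N : ℕ} → V N → List (V N) → List (V N)
insert y W = if does (any? (λ z → ≡-dec BoolP._≟_ y z) W) then W else y ∷ W

elemTrans : {N : ℕ} → Graph N → List (V N) → V N → V N → List (V N)
elemTrans Γ W u x = insert (τ Γ u x) (filterᵇ (λ y → not (y == x)) W)

runChain : {N : ℕ} → Graph N → List (V N) → V N → List (V N) → List (V N)
runChain Γ W x []       = W
runChain Γ W x (u ∷ us) = runChain Γ (elemTrans Γ W u x) (τ Γ u x) us

chainImage : {N : ℕ} → Graph N → V N → List (V N) → V N
chainImage Γ x us = foldl (λ y u → τ Γ u y) x us

-- degree of x in the graph induced on the set W
-- (distinct x, y adjacent iff Q(x+y) = 1)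
degInduced : {N : ℕ} → Graph N → List (V N) → V N → ℕ
degInduced Γ W x = length (filterᵇ (λ y → not (y == x) ∧ Q Γ (x ⊕ y)) W)

CycAdj : (n : ℕ) → Fin n → Fin n → Set
CycAdj n i j = (toℕ j ≡ suc (toℕ i)) ⊎ (toℕ i ≡ suc (toℕ j))
             ⊎ (toℕ i ≡ 0 × suc (toℕ j) ≡ n) ⊎ (toℕ j ≡ 0 × suc (toℕ i) ≡ n)

MinimalCycle : {N : ℕ} → Graph N → (n : ℕ) → (Fin n → Fin N) → Set
MinimalCycle Γ n c =
  (3 ≤ n)
  × (∀ i j → c i ≡ c j → i ≡ j)
  × (∀ i j → (adj Γ (c i) (c j) ≡ true → CycAdj n i j) × (CycAdj n i j → adj Γ (c i) (c j) ≡ true))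

-- the indices 1, …, n-2 (i.e. the vertices v₂, …, v_{n-1})
middle : (n : ℕ) → List (Fin n)
middle n = filterᵇ (λ k → (0 <ᵇ toℕ k) ∧ (suc (toℕ k) <ᵇ n)) (allFin n)

middleVecs : {N n : ℕ} → (Fin n → Fin N) → List (V N)
middleVecs {N} {n} c = map (λ k → vec (c k)) (middle n)

Δset : {N n : ℕ} → Graph N → (c : Fin n → Fin N) → Fin N → List (Fin N) → List (V N)
Δset {N} Γ c v ws =
  foldl (λ W w → runChain Γ W (vec w) (middleVecs c))
        (runChain Γ (map vec (allFin N)) (vec v) (middleVecs c))
        ws

-- Every transvection τ_u used here has Q(u) = 1, so it preserves Q and f; hence in the graph induced
-- on vectors with Q = 1, adjacency to x = τ_{v_{n-1}} ⋯ τ_{v_2}(v) is y ↦ f(x, y). No τ_{v_i} touches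
-- the coordinate of the vertex being moved (v and the w_j lie off v_2, …, v_{n-1}), so each moved
-- vector keeps that coordinate, is never already present, and the vertex set of Δ is that of Γ with
-- v replaced by x and each w_j by its image; the v_i themselves stay. Images under a common
-- sequence of transvections pair as their originals did, so x is adjacent to the image of w_j exactly
-- when v ~ w_j. On C every step acts: C being chordless, only v_{i-1} among v_1, …, v_{i-1} is
-- adjacent to v_i, so f(v_1 + ⋯ + v_{i-1}, v_i) = 1 and τ_{v_i} adds v_i. Thus x = v_1 + ⋯ + v_{n-1},
-- which among v_2, …, v_n pairs only with v_{n-1}: on C, x has one neighbour where v had two.

module Submission where

open import Defs
open import Data.Bool using (Bool; true; false; not; _∧_; _∨_; _xor_; T; T?; if_then_else_)
import Data.Bool.Properties as Bool
open import Data.Bool.Solver using (module xor-∧-Solver)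
open import Data.Empty using (⊥-elim)
open import Data.Fin using (Fin; zero; suc; toℕ; _≟_)
open import Data.Fin.Properties using (<-cmp) renaming (any? to anyFin?)
open import Data.List using (List; []; _∷_; _++_; map; filterᵇ; length; allFin; foldl; tabulate)
open import Data.List.Properties
  using (length-++; filter-++; map-tabulate; map-∘; ∷-injectiveˡ; ∷-injectiveʳ)
open import Data.List.Membership.Propositional using (_∈_; _∉_)
open import Data.List.Membership.Propositional.Properties
  using (∈-filter⁺; ∈-filter⁻; ∈-map⁺; ∈-map⁻; ∈-++⁺ˡ; ∈-++⁺ʳ; ∈-allFin)
open import Data.List.Relation.Unary.All as All using (All; []; _∷_)
open import Data.List.Relation.Unary.All.Properties using (all-filter; map⁺; ¬Any⇒All¬)
open import Data.List.Relation.Unary.Any using (here; there; any?)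
open import Data.List.Relation.Unary.AllPairs using (_∷_)
open import Data.List.Relation.Unary.Unique.Propositional using (Unique)
import Data.List.Relation.Unary.Unique.Propositional.Properties as Unique
open import Data.Nat using (ℕ; zero; suc; _+_; _∸_; _<_; _≤_; _≡ᵇ_; _<ᵇ_; s≤s; z≤n)
import Data.Nat.Properties as ℕ
open import Algebra.Properties.CommutativeSemigroup ℕ.+-commutativeSemigroup
  using (x∙yz≈y∙xz; xy∙z≈zy∙x; x∙yz≈xz∙y; xy∙z≈xz∙y)
open import Data.Product using (_×_; _,_; proj₁; proj₂)
open import Data.Sum using (_⊎_; inj₁; inj₂)
open import Data.Vec using (lookup)
open import Data.Vec.Properties using (≡-dec; lookup-zipWith; lookup∘tabulate)
open import Function using (_∘_; id; _⇔_; mk⇔)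
open import Function.Properties.Equivalence using () renaming (trans to ⇔-trans; sym to ⇔-sym)
open import Relation.Binary.Definitions using (DecidableEquality; tri<; tri≈; tri>)
open import Relation.Binary.PropositionalEquality
open import Relation.Nullary using (does; ¬_; yes; no)
open import Relation.Nullary.Decidable using (dec-true; dec-false)
open import Relation.Nullary.Reflects using (ofʸ; ofⁿ; det)

open xor-∧-Solver using (solve; _:+_; _:*_; _:=_; con)
open ≡-Reasoning

private variable
  A B : Set

boolToℕ : Bool → ℕ
boolToℕ false = 0
boolToℕ true  = 1

count : (A → Bool) → List A → ℕ
count p xs = length (filterᵇ p xs)

count-∷ : (p : A → Bool) (x : A) (xs : List A) → count p (x ∷ xs) ≡ boolToℕ (p x) + count p xs
count-∷ p x xs with p x
... | true  = refl
... | false = refl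

count-++ : (p : A → Bool) (xs ys : List A) → count p (xs ++ ys) ≡ count p xs + count p ys
count-++ p xs ys = trans (cong length (filter-++ (T? ∘ p) xs ys)) (length-++ (filterᵇ p xs))

count-map : (p : B → Bool) (h : A → B) (xs : List A) → count p (map h xs) ≡ count (p ∘ h) xs
count-map p h []       = refl
count-map p h (x ∷ xs) = begin
  count p (h x ∷ map h xs)              ≡⟨ count-∷ p (h x) (map h xs) ⟩
  boolToℕ (p (h x)) + count p (map h xs) ≡⟨ cong (boolToℕ (p (h x)) +_) (count-map p h xs) ⟩
  boolToℕ (p (h x)) + count (p ∘ h) xs   ≡⟨ count-∷ (p ∘ h) x xs ⟨
  count (p ∘ h) (x ∷ xs)                ∎

count-cong : {p q : A → Bool} → (∀ x → p x ≡ q x) → (xs : List A) → count p xs ≡ count q xs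
count-cong {p = p} {q = q} p≗q []       = refl
count-cong {p = p} {q = q} p≗q (x ∷ xs) = begin
  count p (x ∷ xs)                ≡⟨ count-∷ p x xs ⟩
  boolToℕ (p x) + count p xs       ≡⟨ cong₂ _+_ (cong boolToℕ (p≗q x)) (count-cong p≗q xs) ⟩
  boolToℕ (q x) + count q xs       ≡⟨ count-∷ q x xs ⟨
  count q (x ∷ xs)                ∎

count-false : (xs : List A) → count (λ _ → false) xs ≡ 0
count-false []       = refl
count-false (_ ∷ xs) = count-false xs

count-allFin-suc : ∀ {L} (p : Fin (suc L) → Bool) →
                   count p (allFin (suc L)) ≡ boolToℕ (p zero) + count (p ∘ suc) (allFin L)
count-allFin-suc {L} p = begin
  count p (allFin (suc L))
    ≡⟨ count-∷ p zero (tabulate suc) ⟩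
  boolToℕ (p zero) + count p (tabulate suc)
    ≡⟨ cong (λ xs → boolToℕ (p zero) + count p xs) (map-tabulate id suc) ⟨
  boolToℕ (p zero) + count p (map suc (allFin L))
    ≡⟨ cong (boolToℕ (p zero) +_) (count-map p suc (allFin L)) ⟩
  boolToℕ (p zero) + count (p ∘ suc) (allFin L) ∎

count-toℕ≡ᵇ : ∀ L s → s < L → count (λ j → toℕ j ≡ᵇ s) (allFin L) ≡ 1
count-toℕ≡ᵇ (suc L) zero    _         =
  trans (count-allFin-suc {L} (λ j → toℕ j ≡ᵇ 0)) (cong suc (count-false (allFin L)))
count-toℕ≡ᵇ (suc L) (suc s) (s≤s s<L) =
  trans (count-allFin-suc {L} (λ j → toℕ j ≡ᵇ suc s)) (count-toℕ≡ᵇ L s s<L)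

count-toℕ≡ᵇ-xor : ∀ L s t → s ≢ t → s < L → t < L →
                  count (λ j → (toℕ j ≡ᵇ s) xor (toℕ j ≡ᵇ t)) (allFin L) ≡ 2
count-toℕ≡ᵇ-xor (suc L) s t s≢t s<L t<L =
  trans (count-allFin-suc {L} (λ j → (toℕ j ≡ᵇ s) xor (toℕ j ≡ᵇ t))) (split s t s≢t s<L t<L)
  where
  split : ∀ s t → s ≢ t → s < suc L → t < suc L →
          boolToℕ ((0 ≡ᵇ s) xor (0 ≡ᵇ t))
            + count (λ j → (suc (toℕ j) ≡ᵇ s) xor (suc (toℕ j) ≡ᵇ t)) (allFin L) ≡ 2
  split zero    zero    s≢t _         _         = ⊥-elim (s≢t refl)
  split zero    (suc t) _   _         (s≤s t<L) = cong suc (count-toℕ≡ᵇ L t t<L)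
  split (suc s) zero    _   (s≤s s<L) _         =
    cong suc (trans (count-cong (λ _ → Bool.xor-identityʳ _) (allFin L)) (count-toℕ≡ᵇ L s s<L))
  split (suc s) (suc t) s≢t (s≤s s<L) (s≤s t<L) = count-toℕ≡ᵇ-xor L s t (s≢t ∘ cong suc) s<L t<L

module Removal (_≟ᴬ_ : DecidableEquality A) where

  remove : A → List A → List A
  remove x = filterᵇ (λ y → not (does (y ≟ᴬ x)))

  remove-head : ∀ x xs → remove x (x ∷ xs) ≡ remove x xs
  remove-head x xs rewrite dec-true (x ≟ᴬ x) refl = refl

  remove-≢-head : ∀ {x y} xs → y ≢ x → remove x (y ∷ xs) ≡ y ∷ remove x xs
  remove-≢-head {x} {y} xs y≢x rewrite dec-false (y ≟ᴬ x) y≢x = refl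

  remove-∉ : ∀ {x} xs → x ∉ xs → remove x xs ≡ xs
  remove-∉ []       _    = refl
  remove-∉ (y ∷ xs) x∉yxs =
    trans (remove-≢-head xs (x∉yxs ∘ here ∘ sym)) (cong (y ∷_) (remove-∉ xs (x∉yxs ∘ there)))

  ∈-remove⁺ : ∀ {x y xs} → y ∈ xs → y ≢ x → y ∈ remove x xs
  ∈-remove⁺ {x} {y} y∈xs y≢x =
    ∈-filter⁺ (T? ∘ λ z → not (does (z ≟ᴬ x))) y∈xs (subst (T ∘ not) (sym (dec-false (y ≟ᴬ x) y≢x)) _)

  ∈-remove⁻ : ∀ {x y xs} → y ∈ remove x xs → y ∈ xs × y ≢ x
  ∈-remove⁻ {x} {y} y∈rem with ∈-filter⁻ (T? ∘ λ z → not (does (z ≟ᴬ x))) y∈rem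
  ... | y∈xs , kept = y∈xs , λ y≡x → subst (T ∘ not) (dec-true (y ≟ᴬ x) y≡x) kept

  Unique-remove : ∀ {xs} x → Unique xs → Unique (remove x xs)
  Unique-remove x = Unique.filter⁺ (T? ∘ λ z → not (does (z ≟ᴬ x)))

  count-remove : (p : A → Bool) → ∀ {x xs} → Unique xs → x ∈ xs →
                 count p xs ≡ boolToℕ (p x) + count p (remove x xs)
  count-remove p {x} {x ∷ xs} uniq@(_ ∷ _) (here refl) =
    trans (count-∷ p x xs)
          (cong (λ ys → boolToℕ (p x) + count p ys)
                (sym (trans (remove-head x xs) (remove-∉ xs (Unique.Unique[x∷xs]⇒x∉xs uniq)))))
  count-remove p {x} {y ∷ xs} (y≢xs ∷ uniq) (there x∈xs) = begin
    count p (y ∷ xs)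
      ≡⟨ count-∷ p y xs ⟩
    boolToℕ (p y) + count p xs
      ≡⟨ cong (boolToℕ (p y) +_) (count-remove p uniq x∈xs) ⟩
    boolToℕ (p y) + (boolToℕ (p x) + count p (remove x xs))
      ≡⟨ x∙yz≈y∙xz (boolToℕ (p y)) (boolToℕ (p x)) _ ⟩
    boolToℕ (p x) + (boolToℕ (p y) + count p (remove x xs))
      ≡⟨ cong (boolToℕ (p x) +_) (count-∷ p y (remove x xs)) ⟨
    boolToℕ (p x) + count p (y ∷ remove x xs)
      ≡⟨ cong (λ ys → boolToℕ (p x) + count p ys) (remove-≢-head xs (All.lookup y≢xs x∈xs)) ⟨
    boolToℕ (p x) + count p (remove x (y ∷ xs)) ∎

  count-replace : (p : A → Bool) → ∀ {x y xs} → Unique xs → x ∈ xs →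
                  count p (y ∷ remove x xs) + boolToℕ (p x) ≡ count p xs + boolToℕ (p y)
  count-replace p {x} {y} {xs} uniq x∈xs = begin
    count p (y ∷ remove x xs) + boolToℕ (p x)               ≡⟨ cong (_+ boolToℕ (p x)) (count-∷ p y (remove x xs)) ⟩
    boolToℕ (p y) + count p (remove x xs) + boolToℕ (p x)   ≡⟨ xy∙z≈zy∙x (boolToℕ (p y)) _ _ ⟩
    boolToℕ (p x) + count p (remove x xs) + boolToℕ (p y)   ≡⟨ cong (_+ boolToℕ (p y)) (count-remove p uniq x∈xs) ⟨
    count p xs + boolToℕ (p y)                               ∎

  count-resp-set : (p : A → Bool) → ∀ {xs ys} → Unique xs → Unique ys →
                   (∀ {z} → z ∈ xs → z ∈ ys) → (∀ {z} → z ∈ ys → z ∈ xs) → count p xs ≡ count p ys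
  count-resp-set p {[]}     {[]}     _ _ _ _ = refl
  count-resp-set p {[]}     {y ∷ ys} _ _ _ ys⊆xs with ys⊆xs (here refl)
  ... | ()
  count-resp-set p {x ∷ xs} {ys} uniqx@(_ ∷ uniqxs) uniqys xs⊆ys ys⊆xs = begin
    count p (x ∷ xs)
      ≡⟨ count-∷ p x xs ⟩
    boolToℕ (p x) + count p xs
      ≡⟨ cong (boolToℕ (p x) +_) (count-resp-set p uniqxs (Unique-remove x uniqys) into back) ⟩
    boolToℕ (p x) + count p (remove x ys)
      ≡⟨ count-remove p uniqys (xs⊆ys (here refl)) ⟨
    count p ys ∎
    where
    into : ∀ {z} → z ∈ xs → z ∈ remove x ys
    into z∈xs = ∈-remove⁺ (xs⊆ys (there z∈xs)) λ { refl → Unique.Unique[x∷xs]⇒x∉xs uniqx z∈xs }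
    back : ∀ {z} → z ∈ remove x ys → z ∈ xs
    back z∈rem with ∈-remove⁻ z∈rem
    ... | z∈ys , z≢x with ys⊆xs z∈ys
    ...   | here z≡x   = ⊥-elim (z≢x z≡x)
    ...   | there z∈xs = z∈xs

count-partition : ∀ {N m} (c : Fin m → Fin N) → (∀ i j → c i ≡ c j → i ≡ j) →
                  (ws : List (Fin N)) → Unique ws →
                  (∀ x → (x ∈ ws → ∀ i → c i ≢ x) × ((∀ i → c i ≢ x) → x ∈ ws)) →
                  (h : Fin N → Bool) → count h (allFin N) ≡ count (h ∘ c) (allFin m) + count h ws
count-partition {N} {m} c c-inj ws ws-unique ws-complement h = begin
  count h (allFin N)
    ≡⟨ count-resp-set h (Unique.allFin⁺ N) cs++ws-unique (λ {z} _ → every z) (λ _ → ∈-allFin _) ⟩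
  count h (cs ++ ws)
    ≡⟨ count-++ h cs ws ⟩
  count h cs + count h ws
    ≡⟨ cong (_+ count h ws) (count-map h c (allFin m)) ⟩
  count (h ∘ c) (allFin m) + count h ws ∎
  where
  open Removal (_≟_ {N})
  cs : List (Fin N)
  cs = map c (allFin m)
  cs++ws-unique : Unique (cs ++ ws)
  cs++ws-unique = Unique.++⁺ (Unique.map⁺ (c-inj _ _) (Unique.allFin⁺ m)) ws-unique disjoint
    where
    disjoint : ∀ {z} → ¬ (z ∈ cs × z ∈ ws)
    disjoint (z∈cs , z∈ws) with ∈-map⁻ c z∈cs
    ... | i , _ , refl = proj₁ (ws-complement (c i)) z∈ws i refl
  every : ∀ z → z ∈ cs ++ ws
  every z with anyFin? (λ i → c i ≟ z)
  ... | yes (i , refl) = ∈-++⁺ˡ (∈-map⁺ c (∈-allFin i))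
  ... | no  ∄i         = ∈-++⁺ʳ cs (proj₂ (ws-complement z) (λ i ci≡z → ∄i (i , ci≡z)))

xor-interchange : ∀ a b c d → (a xor b) xor (c xor d) ≡ (a xor c) xor (b xor d)
xor-interchange = solve 4 (λ a b c d → (a :+ b) :+ (c :+ d) := (a :+ c) :+ (b :+ d)) refl

⊕Σ-cong : ∀ {n} {a b : Fin n → Bool} → (∀ k → a k ≡ b k) → ⊕Σ a ≡ ⊕Σ b
⊕Σ-cong {zero}  _   = refl
⊕Σ-cong {suc n} a≗b = cong₂ _xor_ (a≗b zero) (⊕Σ-cong (a≗b ∘ suc))

⊕Σ-xor : ∀ {n} (a b : Fin n → Bool) → ⊕Σ (λ k → a k xor b k) ≡ ⊕Σ a xor ⊕Σ b
⊕Σ-xor {zero}  _ _ = refl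
⊕Σ-xor {suc n} a b =
  trans (cong ((a zero xor b zero) xor_) (⊕Σ-xor (a ∘ suc) (b ∘ suc)))
        (xor-interchange (a zero) (b zero) (⊕Σ (a ∘ suc)) (⊕Σ (b ∘ suc)))

∧-distribˡ-⊕Σ : ∀ {n} (c : Bool) (a : Fin n → Bool) → c ∧ ⊕Σ a ≡ ⊕Σ (λ k → c ∧ a k)
∧-distribˡ-⊕Σ {zero}  c a = Bool.∧-zeroʳ c
∧-distribˡ-⊕Σ {suc n} c a =
  trans (Bool.∧-distribˡ-xor c (a zero) _) (cong ((c ∧ a zero) xor_) (∧-distribˡ-⊕Σ c (a ∘ suc)))

⊕Σ-false : ∀ {n} → ⊕Σ {n} (λ _ → false) ≡ false
⊕Σ-false {zero}  = refl
⊕Σ-false {suc n} = ⊕Σ-false {n}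

⊕Σ-δ : ∀ {n} (i : Fin n) (h : Fin n → Bool) → ⊕Σ (λ k → does (k ≟ i) ∧ h k) ≡ h i
⊕Σ-δ {suc n} zero h = trans (cong (h zero xor_) (⊕Σ-false {n})) (Bool.xor-identityʳ (h zero))
⊕Σ-δ {suc n} (suc i) h = ⊕Σ-δ i (h ∘ suc)

lookup-⊕ : ∀ {N} (u w : V N) k → lookup (u ⊕ w) k ≡ lookup u k xor lookup w k
lookup-⊕ u w k = lookup-zipWith _xor_ k u w

lookup-vec : ∀ {N} (i k : Fin N) → lookup (vec i) k ≡ does (k ≟ i)
lookup-vec i k = lookup∘tabulate (λ k → does (k ≟ i)) k

lookup-vec-self : ∀ {N} (i : Fin N) → lookup (vec i) i ≡ true
lookup-vec-self i = trans (lookup-vec i i) (dec-true (i ≟ i) refl)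

lookup-vec-≢ : ∀ {N} {i k : Fin N} → i ≢ k → lookup (vec i) k ≡ false
lookup-vec-≢ {i = i} {k} i≢k = trans (lookup-vec i k) (dec-false (k ≟ i) (i≢k ∘ sym))

lookup-vec-true : ∀ {N} {i p : Fin N} → lookup (vec i) p ≡ true → i ≡ p
lookup-vec-true {i = i} {p} ip with i ≟ p
... | yes i≡p = i≡p
... | no  i≢p with () ← trans (sym ip) (lookup-vec-≢ i≢p)

vec-injective : ∀ {N} {i j : Fin N} → vec i ≡ vec j → i ≡ j
vec-injective {i = i} vi≡vj =
  sym (lookup-vec-true (trans (cong (λ v → lookup v i) (sym vi≡vj)) (lookup-vec-self i)))

<ᵇ-true : ∀ {m n} → m < n → (m <ᵇ n) ≡ true
<ᵇ-true {m} {n} m<n = det (ℕ.<ᵇ-reflects-< m n) (ofʸ m<n)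

<ᵇ-false : ∀ {m n} → ¬ m < n → (m <ᵇ n) ≡ false
<ᵇ-false {m} {n} m≮n = det (ℕ.<ᵇ-reflects-< m n) (ofⁿ m≮n)

≡ᵇ-true : ∀ {m n} → m ≡ n → (m ≡ᵇ n) ≡ true
≡ᵇ-true {m} {n} = dec-true (m ℕ.≟ n)

≡ᵇ-false : ∀ {m n} → m ≢ n → (m ≡ᵇ n) ≡ false
≡ᵇ-false {m} {n} = dec-false (m ℕ.≟ n)

module QuadraticForm {N : ℕ} (Γ : Graph N) where

  g-entry : Fin N → Fin N → Bool
  g-entry x y = does (x ≟ y) ∨ ((toℕ x <ᵇ toℕ y) ∧ adj Γ x y)

  g-summand : V N → V N → Fin N → Fin N → Bool
  g-summand u w x y = lookup u x ∧ lookup w y ∧ g-entry x y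

  g-⊕ˡ : ∀ u u′ w → g Γ (u ⊕ u′) w ≡ g Γ u w xor g Γ u′ w
  g-⊕ˡ u u′ w = trans (⊕Σ-cong λ x → trans (⊕Σ-cong (split x)) (⊕Σ-xor (g-summand u w x) (g-summand u′ w x)))
                      (⊕Σ-xor (λ x → ⊕Σ (g-summand u w x)) (λ x → ⊕Σ (g-summand u′ w x)))
    where
    split : ∀ x y → g-summand (u ⊕ u′) w x y ≡ g-summand u w x y xor g-summand u′ w x y
    split x y = trans (cong (_∧ lookup w y ∧ g-entry x y) (lookup-⊕ u u′ x))
                      (Bool.∧-distribʳ-xor (lookup w y ∧ g-entry x y) (lookup u x) (lookup u′ x))

  g-⊕ʳ : ∀ u w w′ → g Γ u (w ⊕ w′) ≡ g Γ u w xor g Γ u w′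
  g-⊕ʳ u w w′ = trans (⊕Σ-cong λ x → trans (⊕Σ-cong (split x)) (⊕Σ-xor (g-summand u w x) (g-summand u w′ x)))
                      (⊕Σ-xor (λ x → ⊕Σ (g-summand u w x)) (λ x → ⊕Σ (g-summand u w′ x)))
    where
    split : ∀ x y → g-summand u (w ⊕ w′) x y ≡ g-summand u w x y xor g-summand u w′ x y
    split x y = trans (cong (λ b → lookup u x ∧ b ∧ g-entry x y) (lookup-⊕ w w′ y))
                      (trans (cong (lookup u x ∧_) (Bool.∧-distribʳ-xor (g-entry x y) (lookup w y) (lookup w′ y)))
                             (Bool.∧-distribˡ-xor (lookup u x) (lookup w y ∧ g-entry x y) (lookup w′ y ∧ g-entry x y)))

  g-vec : ∀ i j → g Γ (vec i) (vec j) ≡ g-entry i j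
  g-vec i j = begin
    g Γ (vec i) (vec j)
      ≡⟨ ⊕Σ-cong (λ x → ⊕Σ-cong λ y → cong₂ (λ a b → a ∧ b ∧ g-entry x y) (lookup-vec i x) (lookup-vec j y)) ⟩
    ⊕Σ (λ x → ⊕Σ λ y → does (x ≟ i) ∧ does (y ≟ j) ∧ g-entry x y)
      ≡⟨ ⊕Σ-cong (λ x → ∧-distribˡ-⊕Σ (does (x ≟ i)) (λ y → does (y ≟ j) ∧ g-entry x y)) ⟨
    ⊕Σ (λ x → does (x ≟ i) ∧ ⊕Σ λ y → does (y ≟ j) ∧ g-entry x y)
      ≡⟨ ⊕Σ-δ i (λ x → ⊕Σ λ y → does (y ≟ j) ∧ g-entry x y) ⟩
    ⊕Σ (λ y → does (y ≟ j) ∧ g-entry i y)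
      ≡⟨ ⊕Σ-δ j (g-entry i) ⟩
    g-entry i j ∎

  g-entry-antisym : ∀ i j → g-entry i j xor g-entry j i ≡ adj Γ i j
  g-entry-antisym i j with <-cmp i j
  ... | tri< i<j i≢j j≮i rewrite dec-false (i ≟ j) i≢j | dec-false (j ≟ i) (i≢j ∘ sym)
                               | <ᵇ-true i<j | <ᵇ-false j≮i = Bool.xor-identityʳ _
  ... | tri≈ _ refl _ rewrite dec-true (i ≟ i) refl | irrefl Γ i = refl
  ... | tri> i≮j i≢j j<i rewrite dec-false (i ≟ j) i≢j | dec-false (j ≟ i) (i≢j ∘ sym)
                               | <ᵇ-false i≮j | <ᵇ-true j<i = adj-sym Γ j i

  f-polar : ∀ u w → f Γ u w ≡ g Γ u w xor g Γ w u
  f-polar u w = begin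
    Q Γ (u ⊕ w) xor Q Γ u xor Q Γ w
      ≡⟨ cong (_xor Q Γ u xor Q Γ w) (trans (g-⊕ˡ u w (u ⊕ w)) (cong₂ _xor_ (g-⊕ʳ u u w) (g-⊕ʳ w u w))) ⟩
    ((g Γ u u xor g Γ u w) xor (g Γ w u xor g Γ w w)) xor g Γ u u xor g Γ w w
      ≡⟨ cancel (g Γ u u) (g Γ u w) (g Γ w u) (g Γ w w) ⟩
    g Γ u w xor g Γ w u ∎
    where
    cancel : ∀ a b c d → ((a xor b) xor (c xor d)) xor a xor d ≡ b xor c
    cancel = solve 4 (λ a b c d → ((a :+ b) :+ (c :+ d)) :+ (a :+ d) := b :+ c) refl

  f-sym : ∀ u w → f Γ u w ≡ f Γ w u
  f-sym u w = trans (f-polar u w) (trans (Bool.xor-comm (g Γ u w) (g Γ w u)) (sym (f-polar w u)))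

  f-self : ∀ u → f Γ u u ≡ false
  f-self u = trans (f-polar u u) (Bool.xor-same (g Γ u u))

  f-⊕ˡ : ∀ u u′ w → f Γ (u ⊕ u′) w ≡ f Γ u w xor f Γ u′ w
  f-⊕ˡ u u′ w = begin
    f Γ (u ⊕ u′) w
      ≡⟨ f-polar (u ⊕ u′) w ⟩
    g Γ (u ⊕ u′) w xor g Γ w (u ⊕ u′)
      ≡⟨ cong₂ _xor_ (g-⊕ˡ u u′ w) (g-⊕ʳ w u u′) ⟩
    (g Γ u w xor g Γ u′ w) xor (g Γ w u xor g Γ w u′)
      ≡⟨ xor-interchange (g Γ u w) (g Γ u′ w) (g Γ w u) (g Γ w u′) ⟩
    (g Γ u w xor g Γ w u) xor (g Γ u′ w xor g Γ w u′)
      ≡⟨ cong₂ _xor_ (f-polar u w) (f-polar u′ w) ⟨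
    f Γ u w xor f Γ u′ w ∎

  f-vec : ∀ i j → f Γ (vec i) (vec j) ≡ adj Γ i j
  f-vec i j = trans (f-polar (vec i) (vec j)) (trans (cong₂ _xor_ (g-vec i j) (g-vec j i)) (g-entry-antisym i j))

  Q-vec : ∀ i → Q Γ (vec i) ≡ true
  Q-vec i rewrite g-vec i i | dec-true (i ≟ i) refl = refl

  Q-⊕ : ∀ u w → Q Γ (u ⊕ w) ≡ Q Γ u xor Q Γ w xor f Γ u w
  Q-⊕ u w = solve 3 (λ a b c → a := b :+ (c :+ (a :+ (b :+ c)))) refl (Q Γ (u ⊕ w)) (Q Γ u) (Q Γ w)

  induced-adj≡f : ∀ {x y} → Q Γ x ≡ true → Q Γ y ≡ true → not (y == x) ∧ Q Γ (x ⊕ y) ≡ f Γ x y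
  induced-adj≡f {x} {y} Qx Qy with ≡-dec Bool._≟_ y x
  ... | yes refl = sym (f-self x)
  ... | no  _    =
    trans (Q-⊕ x y) (trans (cong₂ (λ a b → a xor b xor f Γ x y) Qx Qy) (Bool.not-involutive (f Γ x y)))

  f-τˡ : ∀ u a z → f Γ (τ Γ u a) z ≡ f Γ a z xor (f Γ u a ∧ f Γ u z)
  f-τˡ u a z with f Γ u a
  ... | true  = f-⊕ˡ a u z
  ... | false = sym (Bool.xor-identityʳ _)

  f-τʳ : ∀ u z b → f Γ z (τ Γ u b) ≡ f Γ z b xor (f Γ u b ∧ f Γ u z)
  f-τʳ u z b = trans (f-sym z (τ Γ u b)) (trans (f-τˡ u b z) (cong (_xor (f Γ u b ∧ f Γ u z)) (f-sym b z)))

  f-τ : ∀ u a b → f Γ (τ Γ u a) (τ Γ u b) ≡ f Γ a b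
  f-τ u a b = begin
    f Γ (τ Γ u a) (τ Γ u b)
      ≡⟨ f-τˡ u a (τ Γ u b) ⟩
    f Γ a (τ Γ u b) xor (f Γ u a ∧ f Γ u (τ Γ u b))
      ≡⟨ cong₂ (λ p q → p xor (f Γ u a ∧ q)) (f-τʳ u a b)
               (trans (f-τʳ u u b) (cong (λ s → f Γ u b xor (f Γ u b ∧ s)) (f-self u))) ⟩
    (f Γ a b xor (f Γ u b ∧ f Γ u a)) xor (f Γ u a ∧ (f Γ u b xor (f Γ u b ∧ false)))
      ≡⟨ cancel (f Γ a b) (f Γ u a) (f Γ u b) ⟩
    f Γ a b ∎
    where
    cancel : ∀ a b c → (a xor (c ∧ b)) xor (b ∧ (c xor (c ∧ false))) ≡ a
    cancel = solve 3 (λ a b c → (a :+ (c :* b)) :+ (b :* (c :+ (c :* con false))) := a) refl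

  Q-τ : ∀ u x → Q Γ u ≡ true → Q Γ (τ Γ u x) ≡ Q Γ x
  Q-τ u x Qu with f Γ u x in fux
  ... | false = refl
  ... | true  = begin
    Q Γ (x ⊕ u)                      ≡⟨ Q-⊕ x u ⟩
    Q Γ x xor Q Γ u xor f Γ x u      ≡⟨ cong₂ (λ a b → Q Γ x xor a xor b) Qu (trans (f-sym x u) fux) ⟩
    Q Γ x xor true xor true          ≡⟨ Bool.xor-identityʳ (Q Γ x) ⟩
    Q Γ x                            ∎

  lookup-τ : ∀ u x {p} → lookup u p ≡ false → lookup (τ Γ u x) p ≡ lookup x p
  lookup-τ u x {p} up with f Γ u x
  ... | false = refl
  ... | true  = trans (lookup-⊕ x u p) (trans (cong (lookup x p xor_) up) (Bool.xor-identityʳ _))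

  f-chainImage : ∀ us a b → f Γ (chainImage Γ a us) (chainImage Γ b us) ≡ f Γ a b
  f-chainImage []       a b = refl
  f-chainImage (u ∷ us) a b = trans (f-chainImage us (τ Γ u a) (τ Γ u b)) (f-τ u a b)

  Q-chainImage : ∀ {us} a → All (λ u → Q Γ u ≡ true) us → Q Γ (chainImage Γ a us) ≡ Q Γ a
  Q-chainImage a []                  = refl
  Q-chainImage a (_∷_ {u} Qu Qus) = trans (Q-chainImage (τ Γ u a) Qus) (Q-τ u a Qu)

  lookup-chainImage : ∀ {us} a {p} → All (λ u → lookup u p ≡ false) us →
                      lookup (chainImage Γ a us) p ≡ lookup a p
  lookup-chainImage a []                = refl
  lookup-chainImage a (_∷_ {u} up ups) = trans (lookup-chainImage (τ Γ u a) ups) (lookup-τ u a up)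

module Transformation {N : ℕ} (Γ : Graph N) where
  open QuadraticForm Γ
  open Removal {V N} (≡-dec Bool._≟_) public

  NoOtherContains : Fin N → List (V N) → V N → Set
  NoOtherContains p W x = ∀ {y} → y ∈ W → lookup y p ≡ true → y ≡ x

  ∉-remove : ∀ {p W x y} → NoOtherContains p W x → lookup y p ≡ true → y ∉ remove x W
  ∉-remove sole yp y∈rem with ∈-remove⁻ y∈rem
  ... | y∈W , y≢x = y≢x (sole y∈W yp)

  NoOtherContains-replace : ∀ {p W x y} → NoOtherContains p W x → NoOtherContains p (y ∷ remove x W) y
  NoOtherContains-replace sole (here y′≡y)    _   = y′≡y
  NoOtherContains-replace sole (there y′∈rem) y′p with ∈-remove⁻ y′∈rem
  ... | y′∈W , y′≢x = ⊥-elim (y′≢x (sole y′∈W y′p))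

  NoOtherContains-∷-remove : ∀ {p W x y z} → NoOtherContains p W x → lookup y p ≡ false →
                             NoOtherContains p (y ∷ remove z W) x
  NoOtherContains-∷-remove sole yp (here refl)    y′p with () ← trans (sym yp) y′p
  NoOtherContains-∷-remove sole yp (there y′∈rem) y′p = sole (proj₁ (∈-remove⁻ y′∈rem)) y′p

  insert-∉ : ∀ {y : V N} {W} → y ∉ W → insert y W ≡ y ∷ W
  insert-∉ {y} {W} y∉W with any? (λ z → ≡-dec Bool._≟_ y z) W
  ... | yes y∈W = ⊥-elim (y∉W y∈W)
  ... | no  _   = refl

  elemTrans-tagged : ∀ {p W x u} → lookup x p ≡ true → lookup u p ≡ false → NoOtherContains p W x →
                     elemTrans Γ W u x ≡ τ Γ u x ∷ remove x W
  elemTrans-tagged {x = x} {u} xp up sole = insert-∉ (∉-remove sole (trans (lookup-τ u x up) xp))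

  -- The implicit arguments are supplied below: left to unification, they make Agda unfold τ and insert.
  runChain-tagged : ∀ {p W x u us} → lookup x p ≡ true → All (λ u → lookup u p ≡ false) (u ∷ us) →
                    NoOtherContains p W x → runChain Γ W x (u ∷ us) ≡ chainImage Γ x (u ∷ us) ∷ remove x W
  runChain-tagged {p} {W} {x} {u} {[]}      xp (up ∷ []) sole = elemTrans-tagged {p} {W} {x} {u} xp up sole
  runChain-tagged {p} {W} {x} {u} {u′ ∷ us} xp (up ∷ ups) sole = begin
    runChain Γ (elemTrans Γ W u x) x′ (u′ ∷ us)
      ≡⟨ cong (λ W′ → runChain Γ W′ x′ (u′ ∷ us)) (elemTrans-tagged {p} {W} {x} {u} xp up sole) ⟩
    runChain Γ (x′ ∷ remove x W) x′ (u′ ∷ us)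
      ≡⟨ runChain-tagged {p} {x′ ∷ remove x W} {x′} {u′} {us} x′p ups
                         (NoOtherContains-replace {p} {W} {x} {x′} sole) ⟩
    chainImage Γ x′ (u′ ∷ us) ∷ remove x′ (x′ ∷ remove x W)
      ≡⟨ cong (chainImage Γ x′ (u′ ∷ us) ∷_)
              (trans (remove-head x′ _) (remove-∉ _ (∉-remove {p} {W} {x} {x′} sole x′p))) ⟩
    chainImage Γ x′ (u′ ∷ us) ∷ remove x W ∎
    where
    x′ : V N
    x′ = τ Γ u x
    x′p : lookup x′ p ≡ true
    x′p = trans (lookup-τ u x up) xp

interval : ℕ → ℕ → List ℕ
interval s zero    = []
interval s (suc l) = s ∷ interval (suc s) l

map-suc-interval : ∀ s l → map suc (interval s l) ≡ interval (suc s) l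
map-suc-interval s zero    = refl
map-suc-interval s (suc l) = cong (suc s ∷_) (map-suc-interval (suc s) l)

toℕ-allFin : ∀ n → map toℕ (allFin n) ≡ interval 0 n
toℕ-allFin zero    = refl
toℕ-allFin (suc n) = cong (0 ∷_) (begin
  map toℕ (tabulate suc)              ≡⟨ map-tabulate suc toℕ ⟩
  tabulate (suc ∘ toℕ)                ≡⟨ map-tabulate id (suc ∘ toℕ) ⟨
  map (suc ∘ toℕ) (allFin n)          ≡⟨ map-∘ (allFin n) ⟩
  map suc (map toℕ (allFin n))        ≡⟨ cong (map suc) (toℕ-allFin n) ⟩
  map suc (interval 0 n)              ≡⟨ map-suc-interval 0 n ⟩
  interval 1 n                        ∎)

map-filterᵇ : (h : A → B) (p : B → Bool) (xs : List A) → map h (filterᵇ (p ∘ h) xs) ≡ filterᵇ p (map h xs)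
map-filterᵇ h p []       = refl
map-filterᵇ h p (x ∷ xs) with p (h x)
... | true  = cong (h x ∷_) (map-filterᵇ h p xs)
... | false = map-filterᵇ h p xs

isMiddle : ℕ → ℕ → Bool
isMiddle n a = (0 <ᵇ a) ∧ (suc a <ᵇ n)

filterᵇ-isMiddle : ∀ {n} s l → suc s + suc l ≡ n →
                   filterᵇ (isMiddle n) (interval (suc s) (suc l)) ≡ interval (suc s) l
filterᵇ-isMiddle {n} s zero    e
  rewrite <ᵇ-false {suc (suc s)} {n} (ℕ.<-irrefl (trans (cong suc (ℕ.+-comm 1 s)) e)) = refl
filterᵇ-isMiddle {n} s (suc l) e
  rewrite <ᵇ-true {suc (suc s)} {n}
            (subst (suc (suc s) <_) e
                   (s≤s (subst (suc (suc s) ≤_) (sym (ℕ.+-suc s (suc l))) (s≤s (ℕ.m<m+n s (s≤s z≤n)))))) =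
  cong (suc s ∷_) (filterᵇ-isMiddle (suc s) l (trans (sym (ℕ.+-suc (suc s) (suc l))) e))

middle-interval : ∀ k → map toℕ (middle (3 + k)) ≡ interval 1 (suc k)
middle-interval k = begin
  map toℕ (filterᵇ (isMiddle (3 + k) ∘ toℕ) (allFin (3 + k)))
    ≡⟨ map-filterᵇ toℕ (isMiddle (3 + k)) (allFin (3 + k)) ⟩
  filterᵇ (isMiddle (3 + k)) (map toℕ (allFin (3 + k)))
    ≡⟨ cong (filterᵇ (isMiddle (3 + k))) (toℕ-allFin (3 + k)) ⟩
  filterᵇ (isMiddle (3 + k)) (interval 0 (3 + k))
    ≡⟨ filterᵇ-isMiddle 0 (suc k) refl ⟩
  interval 1 (suc k) ∎

middle-nonzero : ∀ n → All (λ j → toℕ j ≢ 0) (middle n)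
middle-nonzero n =
  All.map (λ {j} t j≡0 → subst (λ a → T (isMiddle n a)) j≡0 t) (all-filter (T? ∘ isMiddle n ∘ toℕ) (allFin n))

CycAdjℕ : ℕ → ℕ → ℕ → Set
CycAdjℕ n a b = (b ≡ suc a) ⊎ (a ≡ suc b) ⊎ (a ≡ 0 × suc b ≡ n) ⊎ (b ≡ 0 × suc a ≡ n)

cycAdjℕ-first : ∀ {n b} → 1 < n → CycAdjℕ (suc n) 0 b ⇔ (b ≡ 1 ⊎ b ≡ n)
cycAdjℕ-first {n} {b} 1<n = mk⇔ to from
  where
  to : CycAdjℕ (suc n) 0 b → b ≡ 1 ⊎ b ≡ n
  to (inj₁ b≡1)                        = inj₁ b≡1
  to (inj₂ (inj₂ (inj₁ (_ , sb≡sn))))  = inj₂ (ℕ.suc-injective sb≡sn)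
  to (inj₂ (inj₂ (inj₂ (_ , 1≡sn))))   = ⊥-elim (ℕ.<-irrefl (ℕ.suc-injective 1≡sn) (ℕ.<-trans (s≤s z≤n) 1<n))
  from : b ≡ 1 ⊎ b ≡ n → CycAdjℕ (suc n) 0 b
  from (inj₁ b≡1) = inj₁ b≡1
  from (inj₂ b≡n) = inj₂ (inj₂ (inj₁ (refl , cong suc b≡n)))

cycAdjℕ-inner : ∀ {n m b} → suc m < n → CycAdjℕ (suc n) (suc m) b ⇔ (b ≡ m ⊎ b ≡ suc (suc m))
cycAdjℕ-inner {n} {m} {b} sm<n = mk⇔ to from
  where
  to : CycAdjℕ (suc n) (suc m) b → b ≡ m ⊎ b ≡ suc (suc m)
  to (inj₁ b≡ssm)                      = inj₂ b≡ssm
  to (inj₂ (inj₁ sm≡sb))               = inj₁ (sym (ℕ.suc-injective sm≡sb))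
  to (inj₂ (inj₂ (inj₂ (_ , ssm≡sn)))) = ⊥-elim (ℕ.<-irrefl (ℕ.suc-injective ssm≡sn) sm<n)
  from : b ≡ m ⊎ b ≡ suc (suc m) → CycAdjℕ (suc n) (suc m) b
  from (inj₁ b≡m)   = inj₂ (inj₁ (cong suc (sym b≡m)))
  from (inj₂ b≡ssm) = inj₁ b≡ssm

≡ᵇ-xor-true : ∀ {b s t} → s ≢ t → ((b ≡ᵇ s) xor (b ≡ᵇ t)) ≡ true ⇔ (b ≡ s ⊎ b ≡ t)
≡ᵇ-xor-true {b} {s} {t} s≢t = mk⇔ to from
  where
  to : ((b ≡ᵇ s) xor (b ≡ᵇ t)) ≡ true → b ≡ s ⊎ b ≡ t
  to eq with b ≡ᵇ s in b≟s
  ... | true  = inj₁ (ℕ.≡ᵇ⇒≡ b s (subst T (sym b≟s) _))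
  ... | false = inj₂ (ℕ.≡ᵇ⇒≡ b t (subst T (sym eq) _))
  from : b ≡ s ⊎ b ≡ t → ((b ≡ᵇ s) xor (b ≡ᵇ t)) ≡ true
  from (inj₁ refl) rewrite ≡ᵇ-true {b} refl | ≡ᵇ-false {b} s≢t = refl
  from (inj₂ refl) rewrite ≡ᵇ-false {b} (s≢t ∘ sym) | ≡ᵇ-true {b} refl = refl

module Cycle {N : ℕ} (Γ : Graph N) {n : ℕ} (c : Fin (suc n) → Fin N) (mc : MinimalCycle Γ (suc n) c) where

  adj⇔CycAdj : ∀ i j → adj Γ (c i) (c j) ≡ true ⇔ CycAdjℕ (suc n) (toℕ i) (toℕ j)
  adj⇔CycAdj i j = mk⇔ (proj₁ (proj₂ (proj₂ mc) i j)) (proj₂ (proj₂ (proj₂ mc) i j))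

  adj-first : 1 < n → ∀ j → adj Γ (c zero) (c j) ≡ (toℕ j ≡ᵇ 1) xor (toℕ j ≡ᵇ n)
  adj-first 1<n j =
    Bool.⇔→≡ (⇔-trans (adj⇔CycAdj zero j) (⇔-trans (cycAdjℕ-first 1<n) (⇔-sym (≡ᵇ-xor-true (ℕ.<⇒≢ 1<n)))))

  adj-inner : ∀ {m} i j → toℕ i ≡ suc m → suc m < n →
              adj Γ (c i) (c j) ≡ (toℕ j ≡ᵇ m) xor (toℕ j ≡ᵇ suc (suc m))
  adj-inner {m} i j i≡sm sm<n =
    Bool.⇔→≡ (⇔-trans (adj⇔CycAdj i j) (⇔-trans inner (⇔-sym (≡ᵇ-xor-true m≢ssm))))
    where
    inner : CycAdjℕ (suc n) (toℕ i) (toℕ j) ⇔ (toℕ j ≡ m ⊎ toℕ j ≡ suc (suc m))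
    inner = subst (λ a → CycAdjℕ (suc n) a (toℕ j) ⇔ _) (sym i≡sm) (cycAdjℕ-inner sm<n)
    m≢ssm : m ≢ suc (suc m)
    m≢ssm = ℕ.<⇒≢ (ℕ.m<n+m m {2} (s≤s z≤n))

  count-adj-first : 1 < n → count (λ j → adj Γ (c zero) (c j)) (allFin (suc n)) ≡ 2
  count-adj-first 1<n = trans (count-cong (adj-first 1<n) (allFin (suc n)))
                              (count-toℕ≡ᵇ-xor (suc n) 1 n (ℕ.<⇒≢ 1<n) (s≤s (ℕ.<⇒≤ 1<n)) ℕ.≤-refl)

module Arc {N : ℕ} (Γ : Graph N) (k : ℕ) (c : Fin (3 + k) → Fin N) (mc : MinimalCycle Γ (3 + k) c) where
  open QuadraticForm Γ
  open Cycle Γ c mc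

  -- f (c 0 + ⋯ + c m) (c b): the parity of the number of cycle neighbours of c b among c 0, …, c m.
  arcPairing : ℕ → ℕ → Bool
  arcPairing m b = (b ≡ᵇ 0) xor (b ≡ᵇ m) xor (b ≡ᵇ suc m) xor (b ≡ᵇ 2 + k)

  PairsLikeArc : ℕ → V N → Set
  PairsLikeArc m x = ∀ j → f Γ x (vec (c j)) ≡ arcPairing m (toℕ j)

  arc-start : PairsLikeArc 0 (vec (c zero))
  arc-start j = trans (f-vec (c zero) (c j))
                      (trans (adj-first (s≤s (s≤s z≤n)) j) (pad (toℕ j ≡ᵇ 0) (toℕ j ≡ᵇ 1) (toℕ j ≡ᵇ 2 + k)))
    where
    pad : ∀ a₀ a₁ aₙ → a₁ xor aₙ ≡ a₀ xor a₀ xor a₁ xor aₙ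
    pad = solve 3 (λ a₀ a₁ aₙ → a₁ :+ aₙ := a₀ :+ (a₀ :+ (a₁ :+ aₙ))) refl

  arcPairing-next : ∀ {m} → suc m < 2 + k → arcPairing m (suc m) ≡ true
  arcPairing-next {m} sm<n = begin
    false xor (suc m ≡ᵇ m) xor (suc m ≡ᵇ suc m) xor (suc m ≡ᵇ 2 + k)
      ≡⟨ cong (λ a → false xor a xor (suc m ≡ᵇ suc m) xor (suc m ≡ᵇ 2 + k)) (≡ᵇ-false (ℕ.<⇒≢ (ℕ.n<1+n m) ∘ sym)) ⟩
    false xor false xor (suc m ≡ᵇ suc m) xor (suc m ≡ᵇ 2 + k)
      ≡⟨ cong₂ (λ a b → false xor false xor a xor b) (≡ᵇ-true {suc m} refl) (≡ᵇ-false (ℕ.<⇒≢ sm<n)) ⟩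
    true ∎

  arc-step : ∀ {m x} i → toℕ i ≡ suc m → suc m < 2 + k → PairsLikeArc m x →
             τ Γ (vec (c i)) x ≡ x ⊕ vec (c i) × PairsLikeArc (suc m) (x ⊕ vec (c i))
  arc-step {m} {x} i i≡sm sm<n arc = cong (λ b → if b then x ⊕ vec (c i) else x) v·x , arc′
    where
    v·x : f Γ (vec (c i)) x ≡ true
    v·x = trans (f-sym (vec (c i)) x) (trans (arc i) (trans (cong (arcPairing m) i≡sm) (arcPairing-next sm<n)))
    arc′ : PairsLikeArc (suc m) (x ⊕ vec (c i))
    arc′ j = begin
      f Γ (x ⊕ vec (c i)) (vec (c j))
        ≡⟨ f-⊕ˡ x (vec (c i)) (vec (c j)) ⟩
      f Γ x (vec (c j)) xor f Γ (vec (c i)) (vec (c j))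
        ≡⟨ cong₂ _xor_ (arc j) (trans (f-vec (c i) (c j)) (adj-inner i j i≡sm sm<n)) ⟩
      arcPairing m b xor ((b ≡ᵇ m) xor (b ≡ᵇ suc (suc m)))
        ≡⟨ shift (b ≡ᵇ 0) (b ≡ᵇ m) (b ≡ᵇ suc m) (b ≡ᵇ 2 + k) (b ≡ᵇ suc (suc m)) ⟩
      arcPairing (suc m) b ∎
      where
      b : ℕ
      b = toℕ j
      shift : ∀ a₀ aₘ aₘ₊₁ aₙ aₘ₊₂ →
              (a₀ xor aₘ xor aₘ₊₁ xor aₙ) xor (aₘ xor aₘ₊₂) ≡ a₀ xor aₘ₊₁ xor aₘ₊₂ xor aₙ
      shift = solve 5 (λ a₀ aₘ aₘ₊₁ aₙ aₘ₊₂ → (a₀ :+ (aₘ :+ (aₘ₊₁ :+ aₙ))) :+ (aₘ :+ aₘ₊₂)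
                                           := a₀ :+ (aₘ₊₁ :+ (aₘ₊₂ :+ aₙ))) refl

  arc-chain : ∀ l m ks x → map toℕ ks ≡ interval (suc m) l → m + l < 2 + k → PairsLikeArc m x →
              PairsLikeArc (m + l) (chainImage Γ x (map (λ j → vec (c j)) ks))
  arc-chain zero    m []       x _  _   arc = subst (λ m′ → PairsLikeArc m′ x) (sym (ℕ.+-identityʳ m)) arc
  arc-chain (suc l) m (i ∷ ks) x ks≡ ml<n arc =
    subst (λ m′ → PairsLikeArc m′ (chainImage Γ x (map (λ j → vec (c j)) (i ∷ ks)))) (sym (ℕ.+-suc m l))
          (subst (λ y → PairsLikeArc (suc m + l) (chainImage Γ y (map (λ j → vec (c j)) ks))) (sym (proj₁ advance))
                 (arc-chain l (suc m) ks (x ⊕ vec (c i)) (∷-injectiveʳ ks≡) sml<n (proj₂ advance)))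
    where
    sml<n : suc m + l < 2 + k
    sml<n = subst (_< 2 + k) (ℕ.+-suc m l) ml<n
    advance : τ Γ (vec (c i)) x ≡ x ⊕ vec (c i) × PairsLikeArc (suc m) (x ⊕ vec (c i))
    advance = arc-step i (∷-injectiveˡ ks≡) (ℕ.≤-<-trans (s≤s (ℕ.m≤m+n m l)) sml<n) arc

  arcPairing-last : ∀ b → arcPairing (suc k) b ≡ (b ≡ᵇ 0) xor (b ≡ᵇ suc k)
  arcPairing-last b = collapse (b ≡ᵇ 0) (b ≡ᵇ suc k) (b ≡ᵇ 2 + k)
    where
    collapse : ∀ a₀ aₖ aₙ → a₀ xor aₖ xor aₙ xor aₙ ≡ a₀ xor aₖ
    collapse = solve 3 (λ a₀ aₖ aₙ → a₀ :+ (aₖ :+ (aₙ :+ aₙ)) := a₀ :+ aₖ) refl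

  arc-final : ∀ j → f Γ (chainImage Γ (vec (c zero)) (middleVecs c)) (vec (c j))
                    ≡ (toℕ j ≡ᵇ 0) xor (toℕ j ≡ᵇ suc k)
  arc-final j = trans (arc-chain (suc k) 0 (middle (3 + k)) (vec (c zero)) (middle-interval k) ℕ.≤-refl arc-start j)
                      (arcPairing-last (toℕ j))

-- The cycle has length 3 + k and c j is the vertex v_{j+1} of the statement.
module DegreeInΔ {N : ℕ} (Γ : Graph N) (k : ℕ) (c : Fin (3 + k) → Fin N) (mc : MinimalCycle Γ (3 + k) c)
                 (ws : List (Fin N)) (ws-unique : Unique ws)
                 (ws-complement : ∀ x → (x ∈ ws → ∀ i → c i ≢ x) × ((∀ i → c i ≢ x) → x ∈ ws)) where
  open QuadraticForm Γ
  open Transformation Γ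
  open Cycle Γ c mc
  open Arc Γ k c mc

  c-injective : ∀ i j → c i ≡ c j → i ≡ j
  c-injective = proj₁ (proj₂ mc)

  us : List (V N)
  us = middleVecs c

  image : Fin N → V N
  image i = chainImage Γ (vec i) us

  v v′ : V N
  v  = vec (c zero)
  v′ = image (c zero)

  us-Q : All (λ u → Q Γ u ≡ true) us
  us-Q = map⁺ (All.universal (λ j → Q-vec (c j)) (middle (3 + k)))

  us-avoid : ∀ {p} → (∀ j → toℕ j ≢ 0 → c j ≢ p) → All (λ u → lookup u p ≡ false) us
  us-avoid avoid = map⁺ (All.map (λ {j} j≢0 → lookup-vec-≢ (avoid j j≢0)) (middle-nonzero (3 + k)))

  us-avoid-v : All (λ u → lookup u (c zero) ≡ false) us
  us-avoid-v = us-avoid (λ j j≢0 cj≡c₀ → j≢0 (cong toℕ (c-injective j zero cj≡c₀)))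

  us-avoid-ws : ∀ {w} → w ∈ ws → All (λ u → lookup u w ≡ false) us
  us-avoid-ws {w} w∈ws = us-avoid (λ j _ → proj₁ (ws-complement w) w∈ws j)

  Q-image : ∀ i → Q Γ (image i) ≡ true
  Q-image i = trans (Q-chainImage (vec i) us-Q) (Q-vec i)

  image-tag : ∀ {p} → All (λ u → lookup u p ≡ false) us → lookup (image p) p ≡ true
  image-tag {p} us-avoid-p = trans (lookup-chainImage (vec p) us-avoid-p) (lookup-vec-self p)

  image-avoids : ∀ {i w} → w ∈ ws → i ≢ w → lookup (image i) w ≡ false
  image-avoids {i} w∈ws i≢w = trans (lookup-chainImage (vec i) (us-avoid-ws w∈ws)) (lookup-vec-≢ i≢w)

  W₀ W₁ : List (V N)
  W₀ = map vec (allFin N)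
  W₁ = runChain Γ W₀ v us

  W₀-unique : Unique W₀
  W₀-unique = Unique.map⁺ vec-injective (Unique.allFin⁺ N)

  W₀-tagged : ∀ p → NoOtherContains p W₀ (vec p)
  W₀-tagged p y∈W₀ yp with ∈-map⁻ vec y∈W₀
  ... | i , _ , refl = cong vec (lookup-vec-true yp)

  W₁≡ : W₁ ≡ v′ ∷ remove v W₀
  W₁≡ = runChain-tagged (lookup-vec-self (c zero)) us-avoid-v (W₀-tagged (c zero))

  process : List (V N) → Fin N → List (V N)
  process W w = runChain Γ W (vec w) us

  process≡ : ∀ {W w} → w ∈ ws → NoOtherContains w W (vec w) → process W w ≡ image w ∷ remove (vec w) W
  process≡ {W} {w} w∈ws = runChain-tagged (lookup-vec-self w) (us-avoid-ws w∈ws)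

  Ready : List (Fin N) → List (V N) → Set
  Ready rest W = Unique W × (∀ {w} → w ∈ rest → vec w ∈ W × NoOtherContains w W (vec w))

  Ready-replace : ∀ {rest W p x y} → Ready rest W → NoOtherContains p W x → lookup y p ≡ true →
                  (∀ {w} → w ∈ rest → x ≢ vec w × lookup y w ≡ false) → Ready rest (y ∷ remove x W)
  Ready-replace (W-unique , ready) x-tagged yp fresh =
      ¬Any⇒All¬ _ (∉-remove x-tagged yp) ∷ Unique-remove _ W-unique
    , λ w∈rest → there (∈-remove⁺ (proj₁ (ready w∈rest)) (proj₁ (fresh w∈rest) ∘ sym))
               , NoOtherContains-∷-remove (proj₂ (ready w∈rest)) (proj₂ (fresh w∈rest))

  W₁-ready : Ready ws W₁
  W₁-ready = subst (Ready ws) (sym W₁≡)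
               (Ready-replace (W₀-unique , λ {w} _ → ∈-map⁺ vec (∈-allFin w) , W₀-tagged w)
                              (W₀-tagged (c zero)) (image-tag us-avoid-v)
                              (λ w∈ws → let c₀≢w = proj₁ (ws-complement _) w∈ws zero in
                                        c₀≢w ∘ vec-injective , image-avoids w∈ws c₀≢w))

  fold-count : ∀ rest W → Unique rest → (∀ {w} → w ∈ rest → w ∈ ws) → Ready rest W → (p : V N → Bool) →
               count p (foldl process W rest) + count (p ∘ vec) rest ≡ count p W + count (p ∘ image) rest
  fold-count []         W _                        _       _                 p = refl
  fold-count (w ∷ rest) W (w∉rest ∷ rest-unique) rest⊆ws (W-unique , ready) p = begin
    count p (foldl process W′ rest) + count (p ∘ vec) (w ∷ rest)
      ≡⟨ cong (count p (foldl process W′ rest) +_) (count-∷ (p ∘ vec) w rest) ⟩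
    count p (foldl process W′ rest) + (boolToℕ (p (vec w)) + count (p ∘ vec) rest)
      ≡⟨ x∙yz≈xz∙y (count p (foldl process W′ rest)) _ _ ⟩
    count p (foldl process W′ rest) + count (p ∘ vec) rest + boolToℕ (p (vec w))
      ≡⟨ cong (_+ boolToℕ (p (vec w))) (fold-count rest W′ rest-unique (rest⊆ws ∘ there) ready′ p) ⟩
    count p W′ + count (p ∘ image) rest + boolToℕ (p (vec w))
      ≡⟨ xy∙z≈xz∙y (count p W′) _ _ ⟩
    count p W′ + boolToℕ (p (vec w)) + count (p ∘ image) rest
      ≡⟨ cong (λ L → count p L + boolToℕ (p (vec w)) + count (p ∘ image) rest) (process≡ w∈ws w-tagged) ⟩
    count p (image w ∷ remove (vec w) W) + boolToℕ (p (vec w)) + count (p ∘ image) rest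
      ≡⟨ cong (_+ count (p ∘ image) rest) (count-replace p W-unique w∈W) ⟩
    count p W + boolToℕ (p (image w)) + count (p ∘ image) rest
      ≡⟨ ℕ.+-assoc (count p W) _ _ ⟩
    count p W + (boolToℕ (p (image w)) + count (p ∘ image) rest)
      ≡⟨ cong (count p W +_) (count-∷ (p ∘ image) w rest) ⟨
    count p W + count (p ∘ image) (w ∷ rest)
      ∎
    where
    w∈ws : w ∈ ws
    w∈ws = rest⊆ws (here refl)
    W′ : List (V N)
    W′ = process W w
    w∈W : vec w ∈ W
    w∈W = proj₁ (ready (here refl))
    w-tagged : NoOtherContains w W (vec w)
    w-tagged = proj₂ (ready (here refl))
    ready′ : Ready rest W′
    ready′ = subst (Ready rest) (sym (process≡ w∈ws w-tagged))
                   (Ready-replace (W-unique , ready ∘ there) w-tagged (image-tag (us-avoid-ws w∈ws))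
                                  (λ w′∈rest → let w≢w′ = All.lookup w∉rest w′∈rest in
                                               w≢w′ ∘ vec-injective , image-avoids (rest⊆ws (there w′∈rest)) w≢w′))

  adjΔ : V N → Bool
  adjΔ y = not (y == v′) ∧ Q Γ (v′ ⊕ y)

  adjΔ≡f : ∀ {y} → Q Γ y ≡ true → adjΔ y ≡ f Γ v′ y
  adjΔ≡f {y} = induced-adj≡f {v′} {y} (Q-image (c zero))

  degΔ : degInduced Γ (Δset Γ c (c zero) ws) v′ + count (adjΔ ∘ vec) ws
         ≡ count adjΔ W₁ + count (adj Γ (c zero)) ws
  degΔ = trans (fold-count ws W₁ ws-unique id W₁-ready adjΔ)
               (cong (count adjΔ W₁ +_) (count-cong image-adj ws))
    where
    image-adj : ∀ w → adjΔ (image w) ≡ adj Γ (c zero) w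
    image-adj w = trans (adjΔ≡f (Q-image w)) (trans (f-chainImage us v (vec w)) (f-vec (c zero) w))

  count-W₀ : count adjΔ W₀ ≡ suc (count adjΔ W₁)
  count-W₀ = begin
    count adjΔ W₀
      ≡⟨ count-remove adjΔ W₀-unique (∈-map⁺ vec (∈-allFin (c zero))) ⟩
    boolToℕ (adjΔ v) + count adjΔ (remove v W₀)
      ≡⟨ cong (λ b → boolToℕ b + count adjΔ (remove v W₀)) v-adjacent ⟩
    suc (count adjΔ (remove v W₀))
      ≡⟨ cong (λ b → suc (boolToℕ b + count adjΔ (remove v W₀))) v′-self ⟨
    suc (boolToℕ (adjΔ v′) + count adjΔ (remove v W₀))
      ≡⟨ cong suc (count-∷ adjΔ v′ (remove v W₀)) ⟨
    suc (count adjΔ (v′ ∷ remove v W₀))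
      ≡⟨ cong (suc ∘ count adjΔ) W₁≡ ⟨
    suc (count adjΔ W₁) ∎
    where
    v-adjacent : adjΔ v ≡ true
    v-adjacent = trans (adjΔ≡f (Q-vec (c zero))) (arc-final zero)
    v′-self : adjΔ v′ ≡ false
    v′-self = trans (adjΔ≡f (Q-image (c zero))) (f-self v′)

  count-W₀-split : count adjΔ W₀ ≡ 2 + count (adjΔ ∘ vec) ws
  count-W₀-split = begin
    count adjΔ W₀
      ≡⟨ count-map adjΔ vec (allFin N) ⟩
    count (adjΔ ∘ vec) (allFin N)
      ≡⟨ count-partition c c-injective ws ws-unique ws-complement (adjΔ ∘ vec) ⟩
    count (adjΔ ∘ vec ∘ c) (allFin (3 + k)) + count (adjΔ ∘ vec) ws
      ≡⟨ cong (_+ count (adjΔ ∘ vec) ws) on-cycle ⟩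
    2 + count (adjΔ ∘ vec) ws ∎
    where
    on-cycle : count (adjΔ ∘ vec ∘ c) (allFin (3 + k)) ≡ 2
    on-cycle = trans (count-cong (λ j → trans (adjΔ≡f (Q-vec (c j))) (arc-final j)) (allFin (3 + k)))
                     (count-toℕ≡ᵇ-xor (3 + k) 0 (suc k) (λ ()) (s≤s z≤n) (ℕ.m<n+m (suc k) {2} (s≤s z≤n)))

  degΓ-split : degΓ Γ (c zero) ≡ 2 + count (adj Γ (c zero)) ws
  degΓ-split = trans (count-partition c c-injective ws ws-unique ws-complement (adj Γ (c zero)))
                     (cong (_+ count (adj Γ (c zero)) ws) (count-adj-first (s≤s (s≤s z≤n))))

lemma3p2 : {N : ℕ} (Γ : Graph N) → Connected Γ
    → (n : ℕ) (c : Fin (suc n) → Fin N) → MinimalCycle Γ (suc n) c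
    → (ws : List (Fin N)) → Unique ws
    → (∀ x → (x ∈ ws → ∀ i → c i ≢ x) × ((∀ i → c i ≢ x) → x ∈ ws))
    → degInduced Γ (Δset Γ c (c zero) ws) (chainImage Γ (vec (c zero)) (middleVecs c))
      ≡ degΓ Γ (c zero) ∸ 1
lemma3p2 Γ _ zero          c (s≤s () , _)        _  _         _
lemma3p2 Γ _ (suc zero)    c (s≤s (s≤s ()) , _)  _  _         _
lemma3p2 Γ _ (suc (suc k)) c mc ws ws-unique ws-complement =
  ℕ.+-cancelʳ-≡ outside _ _ (begin
    degInduced Γ (Δset Γ c (c zero) ws) v′ + outside
      ≡⟨ degΔ ⟩
    count adjΔ W₁ + neighbours
      ≡⟨ cong (_+ neighbours) (ℕ.suc-injective (trans (sym count-W₀) count-W₀-split)) ⟩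
    suc (outside + neighbours)
      ≡⟨ cong suc (ℕ.+-comm outside neighbours) ⟩
    suc neighbours + outside
      ≡⟨ cong (λ d → d ∸ 1 + outside) degΓ-split ⟨
    degΓ Γ (c zero) ∸ 1 + outside ∎)
  where
  open DegreeInΔ Γ k c mc ws ws-unique ws-complement
  outside neighbours : ℕ
  outside    = count (adjΔ ∘ vec) ws
  neighbours = count (adj Γ (c zero)) ws
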